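{- Let $\mathcal M(2)$ be a Möbius plane of order $2$. Then $\mu(\mathcal M(2))=4$.
   Context: A Möbius plane is a pair $(\mathcal P,\mathcal Z)$, where $\mathcal P$ is a set (of points) and $\mathcal Z$ is a set of subsets of $\mathcal P$ (circles), such that: (i) any three pairwise distinct points lie on exactly one circle; (ii) if $z\in\mathcal Z$, $P\in z$ and $Q\in\mathcal P\setminus z$, there is exactly one circle $z'$ through $P$ and $Q$ with $z\cap z'=\{P\}$; (iii) there is at least one circle and every circle has at least three points; (iv) for every circle $z$ there is a point not on $z$. A finite Möbius plane has order $q$ if every circle has $q+1$ points. The point-circle incidence graph $G$ has vertex set $V=\mathcal P\cup\mathcal Z$ and edges $\{P,z\}$ with $P\in z$, with shortest-path distance $d$. A set $S\subseteq V$ is a resolving set if for any two distinct $u,v\in V$ there is $s\in S$ with $d(u,s)\ne d(v,s)$; $\mu(\mathcal M(2))$ is the minimum cardinality of a resolving set of $G$. -}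

module Defs where

open import Data.Nat using (ℕ; zero; suc; _≤_; _<_)
open import Data.Fin using (Fin)
open import Data.Fin.Subset using (Subset; _∈_; _∉_; ∣_∣)
open import Data.Sum using (_⊎_; inj₁; inj₂)
open import Data.Product using (Σ; ∃; ∃-syntax; _×_; _,_)
open import Data.Maybe using (Maybe; just; nothing)
open import Data.List using (List; length)
open import Data.List.Membership.Propositional using () renaming (_∈_ to _∈ₗ_)
open import Data.List.Relation.Unary.Unique.Propositional using (Unique)
open import Relation.Binary.PropositionalEquality using (_≡_; _≢_)
open import Relation.Nullary using (¬_)
open import Function.Definitions using (Injective)

-- A finite Möbius plane: points are Fin n, circles are given by an
-- injective family  circle : Fin m → Subset n  (so the set 𝒵 of circles
-- is the image, a set of subsets of the point set).
record MobiusPlane : Set where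
  field
    n : ℕ
    m : ℕ
    circle : Fin m → Subset n
    circle-inj : Injective _≡_ _≡_ circle
    ax-i-ex : ∀ (P Q R : Fin n) → P ≢ Q → P ≢ R → Q ≢ R →
              ∃[ z ] (P ∈ circle z × Q ∈ circle z × R ∈ circle z)
    ax-i-uniq : ∀ (P Q R : Fin n) → P ≢ Q → P ≢ R → Q ≢ R → ∀ z z' →
                P ∈ circle z → Q ∈ circle z → R ∈ circle z →
                P ∈ circle z' → Q ∈ circle z' → R ∈ circle z' → z ≡ z'
    ax-ii-ex : ∀ (z : Fin m) (P Q : Fin n) → P ∈ circle z → Q ∉ circle z →
               ∃[ z' ] (P ∈ circle z' × Q ∈ circle z' ×
                        (∀ X → X ∈ circle z → X ∈ circle z' → X ≡ P))
    ax-ii-uniq : ∀ (z : Fin m) (P Q : Fin n) → P ∈ circle z → Q ∉ circle z →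
                 ∀ z₁ z₂ →
                 P ∈ circle z₁ → Q ∈ circle z₁ →
                 (∀ X → X ∈ circle z → X ∈ circle z₁ → X ≡ P) →
                 P ∈ circle z₂ → Q ∈ circle z₂ →
                 (∀ X → X ∈ circle z → X ∈ circle z₂ → X ≡ P) →
                 z₁ ≡ z₂
    ax-iii-ex : Fin m
    ax-iii-size : ∀ z → 3 ≤ ∣ circle z ∣
    ax-iv : ∀ z → ∃[ P ] (P ∉ circle z)

module _ (M : MobiusPlane) where
  open MobiusPlane M

  HasOrder : ℕ → Set
  HasOrder q = ∀ z → ∣ circle z ∣ ≡ suc q

  Vertex : Set
  Vertex = Fin n ⊎ Fin m

  data Adj : Vertex → Vertex → Set where
    pc : ∀ {P z} → P ∈ circle z → Adj (inj₁ P) (inj₂ z)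
    cp : ∀ {P z} → P ∈ circle z → Adj (inj₂ z) (inj₁ P)

  data Walk : Vertex → Vertex → ℕ → Set where
    here : ∀ {u} → Walk u u zero
    step : ∀ {u v w k} → Adj u v → Walk v w k → Walk u w (suc k)

  -- shortest-path distance, with nothing = ∞ (no path)
  IsDist : Vertex → Vertex → Maybe ℕ → Set
  IsDist u v (just k) = Walk u v k × (∀ j → j < k → ¬ Walk u v j)
  IsDist u v nothing  = ∀ k → ¬ Walk u v k

  Resolving : List Vertex → Set
  Resolving S = ∀ (u v : Vertex) → u ≢ v →
                ∃[ s ] (s ∈ₗ S × (∀ a b → IsDist u s a → IsDist v s b → a ≢ b))

  MetricDimension : ℕ → Set
  MetricDimension d =
    (∃[ S ] (Unique S × length S ≡ d × Resolving S)) ×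
    (∀ S → Unique S → Resolving S → d ≤ length S)

-- In a Möbius plane of order 2 every circle has exactly three points, and the touching axiom
-- leaves room for exactly five points; by axiom (i) the circles are then precisely the ten
-- 3-subsets of the points, so the plane is isomorphic to the plane of 3-subsets of Fin 5.
-- Any two 3-subsets of a 5-set meet, so all distances in the incidence graph are determined by
-- equality and incidence: 0 or 2 between vertices of the same kind, 1 or 3 between a point and
-- a circle.  In that model, four points resolve every pair of vertices, while for any three
-- vertices some two circles have the same distances to all of them; both facts are checked by
-- exhaustive computation and transported along the isomorphism.
module Submission where

open import Defs

open import Data.Bool using (if_then_else_)
open import Data.Empty using (⊥; ⊥-elim)
open import Data.Fin using (Fin; zero; suc; #_)
open import Data.Fin.Properties using (suc-injective; _≟_; all?; any?)
open import Data.Fin.Subset using (Subset; _∈_; _∉_; ∣_∣; _-_; _∪_; ⁅_⁆; inside; outside)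
open import Data.Fin.Subset.Properties using (x∈p⇒∣p-x∣<∣p∣; x∈p∧x≢y⇒x∈p-y; _∈?_)
open import Data.List using (List; []; _∷_; length; map)
open import Data.List.Properties using (length-map)
open import Data.List.Membership.Propositional using (find; lose) renaming (_∈_ to _∈ₗ_)
open import Data.List.Membership.Propositional.Properties using (∈-map⁻; ∈-map⁺)
open import Data.List.Relation.Binary.Subset.Propositional using (_⊆_)
open import Data.List.Relation.Unary.All using (All; []; _∷_) renaming (all? to allₗ?)
import Data.List.Relation.Unary.All as All
open import Data.List.Relation.Unary.AllPairs using ([]; _∷_)
open import Data.List.Relation.Unary.Any using (here; there) renaming (any? to anyₗ?)
open import Data.List.Relation.Unary.Unique.Propositional using (Unique)
import Data.List.Relation.Unary.Unique.Propositional.Properties as Unique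
open import Data.Maybe using (just; nothing)
open import Data.Maybe.Properties using (just-injective)
open import Data.Nat using (ℕ; zero; suc; _≤_; _<_; z≤n; s≤s)
open import Data.Nat.Properties using (≤-trans; ≤-reflexive; ≤-pred; <-cmp; _≤?_; ≰⇒>)
  renaming (_≟_ to _≟ℕ_)
open import Data.Product using (Σ; ∃-syntax; _×_; _,_; proj₁; proj₂)
open import Data.Sum using (_⊎_; inj₁; inj₂; [_,_]; [_,_]′)
import Data.Sum as Sum
open import Data.Sum.Function.Propositional using (_⊎-↔_)
open import Data.Sum.Properties using (≡-dec; inj₂-injective)
open import Data.Vec using (Vec; []; _∷_)
import Data.Vec as Vec
open import Data.Vec.Membership.Propositional using () renaming (_∈_ to _∈ᵥ_)
open import Data.Vec.Relation.Unary.All using ([]; _∷_)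
open import Data.Vec.Relation.Unary.AllPairs using ([]; _∷_)
import Data.Vec.Relation.Unary.Any as VecAny
open import Data.Vec.Relation.Unary.Any.Properties using (lookup-index)
open import Data.Vec.Relation.Unary.Unique.Propositional using () renaming (Unique to Uniqueᵥ)
open import Data.Vec.Relation.Unary.Unique.Propositional.Properties using (lookup-injective)
open import Function using (_∘_; _↔_; _⇔_; mk⇔; mk↔ₛ′; Inverse; Injection; Equivalence)
open import Function.Definitions using (Injective)
import Function.Properties.Equivalence as ⇔
open import Function.Properties.Inverse using (↔-sym; ↔⇒↣)
open import Relation.Binary.Definitions using (tri<; tri≈; tri>)
open import Relation.Binary.PropositionalEquality
  using (_≡_; _≢_; refl; sym; trans; cong; cong₂; subst; subst₂; ≢-sym; module ≡-Reasoning)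
open import Relation.Nullary using (¬_; Dec; yes; no; does; contradiction)
open import Relation.Nullary.Decidable using (does-⇔; map′; _×-dec_; _→-dec_; ¬?; from-yes)

open Inverse using (to; from; strictlyInverseˡ; strictlyInverseʳ)

private
  variable
    k : ℕ

members : Subset k → List (Fin k)
members []            = []
members (inside ∷ p)  = zero ∷ map suc (members p)
members (outside ∷ p) = map suc (members p)

length-members : (p : Subset k) → length (members p) ≡ ∣ p ∣
length-members []            = refl
length-members (inside ∷ p)  = cong suc (trans (length-map suc (members p)) (length-members p))
length-members (outside ∷ p) = trans (length-map suc (members p)) (length-members p)

∈-members⁻ : (p : Subset k) {x : Fin k} → x ∈ₗ members p → x ∈ p
∈-members⁻ (inside ∷ p) (here refl) = Vec.here
∈-members⁻ (inside ∷ p) (there x∈) with _ , y∈ , refl ← ∈-map⁻ suc x∈ = Vec.there (∈-members⁻ p y∈)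
∈-members⁻ (outside ∷ p) x∈        with _ , y∈ , refl ← ∈-map⁻ suc x∈ = Vec.there (∈-members⁻ p y∈)

members-unique : (p : Subset k) → Unique (members p)
members-unique []            = []
members-unique (inside ∷ p)  = zero∉ (members p) ∷ Unique.map⁺ suc-injective (members-unique p)
  where
  zero∉ : (xs : List (Fin k)) → All (_≢_ {A = Fin (suc k)} zero) (map suc xs)
  zero∉ []       = []
  zero∉ (_ ∷ xs) = (λ ()) ∷ zero∉ xs
members-unique (outside ∷ p) = Unique.map⁺ suc-injective (members-unique p)

length≤∣p∣ : {p : Subset k} {xs : List (Fin k)} → Unique xs → All (_∈ p) xs → length xs ≤ ∣ p ∣
length≤∣p∣ []                  []           = z≤n
length≤∣p∣ (x≢xs ∷ xs-unique) (x∈p ∷ xs∈p) =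
  ≤-trans (s≤s (length≤∣p∣ xs-unique (remove x≢xs xs∈p))) (x∈p⇒∣p-x∣<∣p∣ x∈p)
  where
  remove : ∀ {p : Subset k} {x ys} → All (x ≢_) ys → All (_∈ p) ys → All (_∈ p - x) ys
  remove []            []           = []
  remove (x≢y ∷ x≢ys) (y∈p ∷ ys∈p) = x∈p∧x≢y⇒x∈p-y y∈p (≢-sym x≢y) ∷ remove x≢ys ys∈p

∈∧∉⇒≢ : {p : Subset k} {x y : Fin k} → x ∈ p → y ∉ p → x ≢ y
∈∧∉⇒≢ x∈p y∉p refl = y∉p x∈p

record ThreeElements (p : Subset k) : Set where
  field
    a b c : Fin k
    a≢b   : a ≢ b
    a≢c   : a ≢ c
    b≢c   : b ≢ c
    a∈p   : a ∈ p
    b∈p   : b ∈ p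
    c∈p   : c ∈ p

three-elements : (p : Subset k) → 3 ≤ ∣ p ∣ → ThreeElements p
three-elements p 3≤∣p∣ =
  fromList (members p) (subst (3 ≤_) (sym (length-members p)) 3≤∣p∣) (members-unique p) (∈-members⁻ p)
  where
  fromList : (xs : List (Fin _)) → 3 ≤ length xs → Unique xs → (∀ {x} → x ∈ₗ xs → x ∈ p) →
             ThreeElements p
  fromList (a ∷ b ∷ c ∷ _) _ ((a≢b ∷ a≢c ∷ _) ∷ (b≢c ∷ _) ∷ _) xs⊆p = record
    { a≢b = a≢b ; a≢c = a≢c ; b≢c = b≢c
    ; a∈p = xs⊆p (here refl) ; b∈p = xs⊆p (there (here refl)) ; c∈p = xs⊆p (there (there (here refl))) }
  fromList (_ ∷ [])     (s≤s ())       _ _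
  fromList (_ ∷ _ ∷ []) (s≤s (s≤s ())) _ _

module ThreeElementsProperties {p : Subset k} (t : ThreeElements p) where
  open ThreeElements t

  avoid-two : (x y : Fin k) → ∃[ e ] (e ∈ p × e ≢ x × e ≢ y)
  avoid-two x y = pick (a ≟ x) (a ≟ y) (b ≟ x) (b ≟ y)
    where
    pick : Dec (a ≡ x) → Dec (a ≡ y) → Dec (b ≡ x) → Dec (b ≡ y) → ∃[ e ] (e ∈ p × e ≢ x × e ≢ y)
    pick (no a≢x)   (no a≢y)   _          _          = a , a∈p , a≢x , a≢y
    pick _          _          (no b≢x)   (no b≢y)   = b , b∈p , b≢x , b≢y
    pick (yes refl) _          _          (yes refl) = c , c∈p , ≢-sym a≢c , ≢-sym b≢c
    pick _          (yes refl) (yes refl) _          = c , c∈p , ≢-sym b≢c , ≢-sym a≢c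
    pick (yes refl) _          (yes refl) _          = contradiction refl a≢b
    pick _          (yes refl) _          (yes refl) = contradiction refl a≢b

  three-elements-exhaust : ∣ p ∣ ≡ 3 → ∀ {x} → x ∈ p → x ≡ a ⊎ x ≡ b ⊎ x ≡ c
  three-elements-exhaust ∣p∣≡3 {x} x∈p with x ≟ a | x ≟ b | x ≟ c
  ... | yes x≡a | _       | _       = inj₁ x≡a
  ... | no _    | yes x≡b | _       = inj₂ (inj₁ x≡b)
  ... | no _    | no _    | yes x≡c = inj₂ (inj₂ x≡c)
  ... | no x≢a  | no x≢b  | no x≢c  = contradiction (subst (4 ≤_) ∣p∣≡3 four≤∣p∣) λ { (s≤s (s≤s (s≤s ()))) }
    where
    four≤∣p∣ : 4 ≤ ∣ p ∣
    four≤∣p∣ = length≤∣p∣ ((x≢a ∷ x≢b ∷ x≢c ∷ []) ∷ (a≢b ∷ a≢c ∷ []) ∷ (b≢c ∷ []) ∷ [] ∷ [])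
                           (x∈p ∷ a∈p ∷ b∈p ∷ c∈p ∷ [])

  one-of-three⇒∈ : ∀ {x} → x ≡ a ⊎ x ≡ b ⊎ x ≡ c → x ∈ p
  one-of-three⇒∈ (inj₁ refl)        = a∈p
  one-of-three⇒∈ (inj₂ (inj₁ refl)) = b∈p
  one-of-three⇒∈ (inj₂ (inj₂ refl)) = c∈p

open ThreeElementsProperties

image-of-three : ∀ {k′} {p : Subset k} {q : Subset k′} (t : ThreeElements p) {f : Fin k → Fin k′} →
                 Injective _≡_ _≡_ f → ∣ p ∣ ≡ 3 → ∣ q ∣ ≡ 3 →
                 let open ThreeElements t in f a ∈ q → f b ∈ q → f c ∈ q → ∀ x → x ∈ p ⇔ f x ∈ q
image-of-three {q = q} t {f} f-injective ∣p∣≡3 ∣q∣≡3 fa∈q fb∈q fc∈q x = mk⇔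
  (λ x∈p → one-of-three⇒∈ f-image
             (Sum.map (cong f) (Sum.map (cong f) (cong f)) (three-elements-exhaust t ∣p∣≡3 x∈p)))
  (λ fx∈q → one-of-three⇒∈ t
              (Sum.map f-injective (Sum.map f-injective f-injective) (three-elements-exhaust f-image ∣q∣≡3 fx∈q)))
  where
  open ThreeElements t
  f-image : ThreeElements q
  f-image = record
    { a≢b = a≢b ∘ f-injective ; a≢c = a≢c ∘ f-injective ; b≢c = b≢c ∘ f-injective
    ; a∈p = fa∈q ; b∈p = fb∈q ; c∈p = fc∈q }

enumeration⇒↔ : ∀ {A : Set} {xs : Vec A k} → Uniqueᵥ xs → (∀ x → x ∈ᵥ xs) → A ↔ Fin k
enumeration⇒↔ {xs = xs} unique covers = mk↔ₛ′ (λ x → VecAny.index (covers x)) (Vec.lookup xs)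
  (λ i → lookup-injective unique _ i (sym (lookup-index (covers (Vec.lookup xs i)))))
  (λ x → sym (lookup-index (covers x)))

length≤3⇒⊆triple : ∀ {A : Set} → A → (xs : List A) → length xs ≤ 3 →
                   ∃[ a ] ∃[ b ] ∃[ c ] (xs ⊆ a ∷ b ∷ c ∷ [])
length≤3⇒⊆triple x []                _ = x , x , x , λ ()
length≤3⇒⊆triple x (a ∷ [])          _ = a , a , a , λ { (here refl) → here refl }
length≤3⇒⊆triple x (a ∷ b ∷ [])      _ = a , b , b , λ { (here refl) → here refl
                                                          ; (there (here refl)) → there (here refl) }
length≤3⇒⊆triple x (a ∷ b ∷ c ∷ [])  _ = a , b , c , λ s∈ → s∈
length≤3⇒⊆triple x (_ ∷ _ ∷ _ ∷ _ ∷ _) (s≤s (s≤s (s≤s ())))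

Resolves : {V : Set} → (V → V → ℕ) → List V → Set
Resolves δ S = ∀ u v → u ≢ v → ∃[ s ] (s ∈ₗ S × δ u s ≢ δ v s)

Resolves-⊆ : ∀ {V} {δ : V → V → ℕ} {S T} → S ⊆ T → Resolves δ S → Resolves δ T
Resolves-⊆ S⊆T res u v u≢v with s , s∈S , δ≢ ← res u v u≢v = s , S⊆T s∈S , δ≢

equidistant⇒¬Resolves : ∀ {V} {δ : V → V → ℕ} {u v S} →
                        u ≢ v → All (λ s → δ u s ≡ δ v s) S → ¬ Resolves δ S
equidistant⇒¬Resolves u≢v equidistant res with _ , s∈S , δ≢ ← res _ _ u≢v = δ≢ (All.lookup equidistant s∈S)

Isometry : {A B : Set} → (A → B) → (A → A → ℕ) → (B → B → ℕ) → Set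
Isometry f δ δ′ = ∀ x y → δ′ (f x) (f y) ≡ δ x y

isometry-from : ∀ {A B} {δ : A → A → ℕ} {δ′ : B → B → ℕ} (φ : A ↔ B) →
                Isometry (to φ) δ δ′ → Isometry (from φ) δ′ δ
isometry-from {δ = δ} {δ′} φ iso x y = begin
  δ (from φ x) (from φ y)                 ≡⟨ iso (from φ x) (from φ y) ⟨
  δ′ (to φ (from φ x)) (to φ (from φ y))  ≡⟨ cong₂ δ′ (strictlyInverseˡ φ x) (strictlyInverseˡ φ y) ⟩
  δ′ x y                                  ∎
  where open ≡-Reasoning

Resolves-map-from : ∀ {A B} {δ : A → A → ℕ} {δ′ : B → B → ℕ} (φ : A ↔ B) →
                    Isometry (to φ) δ δ′ → ∀ {S} → Resolves δ′ S → Resolves δ (map (from φ) S)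
Resolves-map-from {δ = δ} {δ′} φ iso res u v u≢v
  with s , s∈S , δ′≢ ← res (to φ u) (to φ v) (u≢v ∘ Injection.injective (↔⇒↣ φ)) =
  from φ s , ∈-map⁺ (from φ) s∈S , λ eq → δ′≢ (trans (sym (δ-from u s)) (trans eq (δ-from v s)))
  where
  δ-from : ∀ x s → δ x (from φ s) ≡ δ′ (to φ x) s
  δ-from x s = trans (sym (iso x (from φ s))) (cong (δ′ (to φ x)) (strictlyInverseˡ φ s))

Resolves-map-to : ∀ {A B} {δ : A → A → ℕ} {δ′ : B → B → ℕ} (φ : A ↔ B) →
                  Isometry (to φ) δ δ′ → ∀ {S} → Resolves δ S → Resolves δ′ (map (to φ) S)
Resolves-map-to φ iso = Resolves-map-from (↔-sym φ) (isometry-from φ iso)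

incidenceDistance : {n m : ℕ} → (Fin m → Subset n) → Fin n ⊎ Fin m → Fin n ⊎ Fin m → ℕ
incidenceDistance circle (inj₁ P) (inj₁ Q) = if does (P ≟ Q) then 0 else 2
incidenceDistance circle (inj₂ z) (inj₂ w) = if does (z ≟ w) then 0 else 2
incidenceDistance circle (inj₁ P) (inj₂ z) = if does (P ∈? circle z) then 1 else 3
incidenceDistance circle (inj₂ z) (inj₁ P) = if does (P ∈? circle z) then 1 else 3

incidence-preserving⇒isometry :
  ∀ {n m n′ m′} {circle : Fin m → Subset n} {circle′ : Fin m′ → Subset n′}
  (σ : Fin n ↔ Fin n′) (τ : Fin m ↔ Fin m′) → (∀ P z → P ∈ circle z ⇔ to σ P ∈ circle′ (to τ z)) →
  Isometry (to (σ ⊎-↔ τ)) (incidenceDistance circle) (incidenceDistance circle′)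
incidence-preserving⇒isometry {circle = circle} {circle′} σ τ ∈⇔ = isometry
  where
  incidence : ∀ P z → does (to σ P ∈? circle′ (to τ z)) ≡ does (P ∈? circle z)
  incidence P z = sym (does-⇔ (∈⇔ P z) (P ∈? circle z) (to σ P ∈? circle′ (to τ z)))
  isometry : Isometry (to (σ ⊎-↔ τ)) (incidenceDistance circle) (incidenceDistance circle′)
  isometry (inj₁ P) (inj₁ Q) = cong (if_then 0 else 2)
    (does-⇔ (mk⇔ (Injection.injective (↔⇒↣ σ)) (cong (to σ))) (to σ P ≟ to σ Q) (P ≟ Q))
  isometry (inj₂ z) (inj₂ w) = cong (if_then 0 else 2)
    (does-⇔ (mk⇔ (Injection.injective (↔⇒↣ τ)) (cong (to τ))) (to τ z ≟ to τ w) (z ≟ w))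
  isometry (inj₁ P) (inj₂ z) = cong (if_then 1 else 3) (incidence P z)
  isometry (inj₂ z) (inj₁ P) = cong (if_then 1 else 3) (incidence P z)

module IncidenceGraph (M : MobiusPlane) where
  open MobiusPlane M

  private
    variable
      u v w : Vertex M
      j : ℕ
      P Q : Fin n
      z z′ : Fin m

  Adj-sym : Adj M u v → Adj M v u
  Adj-sym (pc P∈z) = cp P∈z
  Adj-sym (cp P∈z) = pc P∈z

  walk-snoc : Walk M u v j → Adj M v w → Walk M u w (suc j)
  walk-snoc here          e = step e here
  walk-snoc (step e′ wlk) e = step e′ (walk-snoc wlk e)

  walk-reverse : Walk M u v j → Walk M v u j
  walk-reverse here         = here
  walk-reverse (step e wlk) = walk-snoc (walk-reverse wlk) (Adj-sym e)

  IsDist-sym : IsDist M u v (just j) → IsDist M v u (just j)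
  IsDist-sym (wlk , shortest) = walk-reverse wlk , λ i i<j wlk′ → shortest i i<j (walk-reverse wlk′)

  IsDist-functional : ∀ d → IsDist M u v (just j) → IsDist M u v d → just j ≡ d
  IsDist-functional nothing (wlk , _) no-walk = contradiction wlk (no-walk _)
  IsDist-functional {j = j} (just i) (wlk , shortest) (wlk′ , shortest′) with <-cmp j i
  ... | tri< j<i _    _   = contradiction wlk (shortest′ j j<i)
  ... | tri≈ _    refl _  = refl
  ... | tri> _    _   i<j = contradiction wlk′ (shortest i i<j)

  points-on : ∀ z → ThreeElements (circle z)
  points-on z = three-elements (circle z) (ax-iii-size z)

  circle-through : P ≢ Q → ∃[ z ] (P ∈ circle z × Q ∈ circle z)
  circle-through {P} {Q} P≢Q with R , _ , R≢P , R≢Q ← avoid-two (points-on ax-iii-ex) P Q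
    with z , P∈z , Q∈z , _ ← ax-i-ex P Q R P≢Q (≢-sym R≢P) (≢-sym R≢Q) = z , P∈z , Q∈z

  dist-refl : IsDist M u u (just 0)
  dist-refl = here , λ _ ()

  dist-points : P ≢ Q → IsDist M (inj₁ P) (inj₁ Q) (just 2)
  dist-points {P} {Q} P≢Q with z , P∈z , Q∈z ← circle-through P≢Q =
    step (pc P∈z) (step (cp Q∈z) here) , shorter
    where
    shorter : ∀ i → i < 2 → ¬ Walk M (inj₁ P) (inj₁ Q) i
    shorter zero          _ here             = P≢Q refl
    shorter (suc zero)    _ (step (pc _) ())
    shorter (suc (suc _)) (s≤s (s≤s ()))

  dist-incident : P ∈ circle z → IsDist M (inj₁ P) (inj₂ z) (just 1)
  dist-incident P∈z = step (pc P∈z) here , λ { zero _ () ; (suc _) (s≤s ()) }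

  dist-nonincident : P ∉ circle z → IsDist M (inj₁ P) (inj₂ z) (just 3)
  dist-nonincident {P} {z} P∉z = walk , shorter
    where
    open ThreeElements (points-on z) using () renaming (a to R; a∈p to R∈z)
    walk : Walk M (inj₁ P) (inj₂ z) 3
    walk with w , P∈w , R∈w ← circle-through (λ { refl → P∉z R∈z }) =
      step (pc P∈w) (step (cp R∈w) (step (pc R∈z) here))
    shorter : ∀ i → i < 3 → ¬ Walk M (inj₁ P) (inj₂ z) i
    shorter (suc zero)          _ (step (pc P∈z) here)         = P∉z P∈z
    shorter (suc (suc zero))    _ (step (pc _) (step (cp _) ()))
    shorter (suc (suc (suc _))) (s≤s (s≤s (s≤s ())))

  dist-meeting : z ≢ z′ → P ∈ circle z → P ∈ circle z′ → IsDist M (inj₂ z) (inj₂ z′) (just 2)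
  dist-meeting z≢z′ P∈z P∈z′ = step (cp P∈z) (step (pc P∈z′) here) , shorter
    where
    shorter : ∀ i → i < 2 → ¬ Walk M _ _ i
    shorter zero          _ here             = z≢z′ refl
    shorter (suc zero)    _ (step (cp _) ())
    shorter (suc (suc _)) (s≤s (s≤s ()))

  incidenceDistance-isDist : (∀ z z′ → ∃[ P ] (P ∈ circle z × P ∈ circle z′)) →
                             ∀ u v → IsDist M u v (just (incidenceDistance circle u v))
  incidenceDistance-isDist meet (inj₁ P) (inj₁ Q) with P ≟ Q
  ... | yes refl = dist-refl
  ... | no P≢Q   = dist-points P≢Q
  incidenceDistance-isDist meet (inj₂ z) (inj₂ z′) with z ≟ z′ | meet z z′
  ... | yes refl | _              = dist-refl
  ... | no z≢z′  | P , P∈z , P∈z′ = dist-meeting z≢z′ P∈z P∈z′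
  incidenceDistance-isDist meet (inj₁ P) (inj₂ z) with P ∈? circle z
  ... | yes P∈z = dist-incident P∈z
  ... | no P∉z  = dist-nonincident P∉z
  incidenceDistance-isDist meet (inj₂ z) (inj₁ P) with P ∈? circle z
  ... | yes P∈z = IsDist-sym (dist-incident P∈z)
  ... | no P∉z  = IsDist-sym (dist-nonincident P∉z)

  module _ {δ : Vertex M → Vertex M → ℕ} (δ-isDist : ∀ u v → IsDist M u v (just (δ u v))) where

    resolving⇒resolves : ∀ {S} → Resolving M S → Resolves δ S
    resolving⇒resolves res u v u≢v with s , s∈S , separates ← res u v u≢v =
      s , s∈S , λ eq → separates _ _ (δ-isDist u s) (δ-isDist v s) (cong just eq)

    resolves⇒resolving : ∀ {S} → Resolves δ S → Resolving M S
    resolves⇒resolving res u v u≢v with s , s∈S , δ≢ ← res u v u≢v =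
      s , s∈S , λ a b du dv a≡b → δ≢ (just-injective (begin
        just (δ u s)  ≡⟨ IsDist-functional a (δ-isDist u s) du ⟩
        a             ≡⟨ a≡b ⟩
        b             ≡⟨ IsDist-functional b (δ-isDist v s) dv ⟨
        just (δ v s)  ∎))
      where open ≡-Reasoning

-- The Möbius plane of order 2 on Fin 5

triple : Fin 5 → Fin 5 → Fin 5 → Subset 5
triple a b c = ⁅ a ⁆ ∪ ⁅ b ⁆ ∪ ⁅ c ⁆

modelCircle : Fin 10 → Subset 5
modelCircle = Vec.lookup
  ( triple (# 0) (# 1) (# 2) ∷ triple (# 0) (# 1) (# 3) ∷ triple (# 0) (# 1) (# 4) ∷ triple (# 0) (# 2) (# 3)
  ∷ triple (# 0) (# 2) (# 4) ∷ triple (# 0) (# 3) (# 4) ∷ triple (# 1) (# 2) (# 3) ∷ triple (# 1) (# 2) (# 4)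
  ∷ triple (# 1) (# 3) (# 4) ∷ triple (# 2) (# 3) (# 4) ∷ [])

∣modelCircle∣≡3 : ∀ t → ∣ modelCircle t ∣ ≡ 3
∣modelCircle∣≡3 = from-yes (all? λ t → ∣ modelCircle t ∣ ≟ℕ 3)

modelCircle-⊆⇒≡ : ∀ t t′ → (∀ i → i ∈ modelCircle t → i ∈ modelCircle t′) → t ≡ t′
modelCircle-⊆⇒≡ = from-yes (all? λ t → all? λ t′ →
  (all? λ i → (i ∈? modelCircle t) →-dec (i ∈? modelCircle t′)) →-dec (t ≟ t′))

modelCircle-through : ∀ i j k → i ≢ j → i ≢ k → j ≢ k →
                      ∃[ t ] (i ∈ modelCircle t × j ∈ modelCircle t × k ∈ modelCircle t)
modelCircle-through = from-yes (all? λ i → all? λ j → all? λ k →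
  ¬? (i ≟ j) →-dec ¬? (i ≟ k) →-dec ¬? (j ≟ k) →-dec
  any? λ t → (i ∈? modelCircle t) ×-dec (j ∈? modelCircle t) ×-dec (k ∈? modelCircle t))

modelCircles-meet : ∀ t t′ → ∃[ i ] (i ∈ modelCircle t × i ∈ modelCircle t′)
modelCircles-meet = from-yes (all? λ t → all? λ t′ → any? λ i → (i ∈? modelCircle t) ×-dec (i ∈? modelCircle t′))

ModelVertex : Set
ModelVertex = Fin 5 ⊎ Fin 10

modelDistance : ModelVertex → ModelVertex → ℕ
modelDistance = incidenceDistance modelCircle

∀⊎? : {A B : Set} {P : A ⊎ B → Set} → Dec (∀ a → P (inj₁ a)) → Dec (∀ b → P (inj₂ b)) → Dec (∀ x → P x)
∀⊎? a? b? = map′ (λ (f , g) → [ f , g ]) (λ h → h ∘ inj₁ , h ∘ inj₂) (a? ×-dec b?)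

∀-modelVertex? : {P : ModelVertex → Set} → (∀ x → Dec (P x)) → Dec (∀ x → P x)
∀-modelVertex? P? = ∀⊎? (all? (P? ∘ inj₁)) (all? (P? ∘ inj₂))

modelBasis : List ModelVertex
modelBasis = inj₁ (# 0) ∷ inj₁ (# 1) ∷ inj₁ (# 2) ∷ inj₁ (# 3) ∷ []

modelBasis-unique : Unique modelBasis
modelBasis-unique = ((λ ()) ∷ (λ ()) ∷ (λ ()) ∷ []) ∷ ((λ ()) ∷ (λ ()) ∷ []) ∷ ((λ ()) ∷ []) ∷ [] ∷ []

modelBasis-resolves : Resolves modelDistance modelBasis
modelBasis-resolves = from-yes (∀-modelVertex? λ u → ∀-modelVertex? λ v →
  ¬? (≡-dec _≟_ _≟_ u v) →-dec map′ find (λ (_ , s∈S , δ≢) → lose s∈S δ≢)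
                                (anyₗ? (λ s → ¬? (modelDistance u s ≟ℕ modelDistance v s)) modelBasis))

model-circles-unseparated : ∀ a b c → ∃[ t ] ∃[ t′ ] (t ≢ t′ ×
  All (λ s → modelDistance (inj₂ t) s ≡ modelDistance (inj₂ t′) s) (a ∷ b ∷ c ∷ []))
model-circles-unseparated = from-yes (∀-modelVertex? λ a → ∀-modelVertex? λ b → ∀-modelVertex? λ c →
  any? λ t → any? λ t′ →
  ¬? (t ≟ t′) ×-dec allₗ? (λ s → modelDistance (inj₂ t) s ≟ℕ modelDistance (inj₂ t′) s) (a ∷ b ∷ c ∷ []))

model-no-triple-resolves : ∀ a b c → ¬ Resolves modelDistance (a ∷ b ∷ c ∷ [])
model-no-triple-resolves a b c = let _ , _ , t≢t′ , equidistant = model-circles-unseparated a b c in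
  equidistant⇒¬Resolves (t≢t′ ∘ inj₂-injective) equidistant

module OrderTwo (M : MobiusPlane) (order : HasOrder M 2) where
  open MobiusPlane M
  open IncidenceGraph M

  meets-only-at : ∀ {z w} (t : ThreeElements (circle w)) → let open ThreeElements t in
                  b ∉ circle z → c ∉ circle z → ∀ Y → Y ∈ circle z → Y ∈ circle w → Y ≡ a
  meets-only-at t b∉z c∉z Y Y∈z Y∈w with three-elements-exhaust t (order _) Y∈w
  ... | inj₁ Y≡a         = Y≡a
  ... | inj₂ (inj₁ refl) = contradiction Y∈z b∉z
  ... | inj₂ (inj₂ refl) = contradiction Y∈z c∉z

  z₀ : Fin m
  z₀ = ax-iii-ex

  open ThreeElements (points-on z₀) using () renaming
    (a to A; b to B; c to C; a≢b to A≢B; a≢c to A≢C; b≢c to B≢C; a∈p to A∈z₀; b∈p to B∈z₀; c∈p to C∈z₀)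

  -- A, B, C are the points of z₀, D is a point off z₀, and z₁ = {A, D, E} touches z₀ at A.  Any
  -- sixth point X would lie on a circle through A, D, X that also touches z₀ at A, hence on z₁.
  five-points : Σ (Vec (Fin n) 5) λ xs → Uniqueᵥ xs × (∀ X → X ∈ᵥ xs)
  five-points
    with D , D∉z₀ ← ax-iv z₀
    with z₁ , A∈z₁ , D∈z₁ , z₀∩z₁≡A ← ax-ii-ex z₀ A D A∈z₀ D∉z₀
    with E , E∈z₁ , E≢A , E≢D ← avoid-two (points-on z₁) A D
    = (A ∷ B ∷ C ∷ D ∷ E ∷ []) , distinct , covers
    where
    A≢D : A ≢ D
    A≢D = ∈∧∉⇒≢ A∈z₀ D∉z₀

    E∉z₀ : E ∉ circle z₀
    E∉z₀ E∈z₀ = E≢A (z₀∩z₁≡A E E∈z₀ E∈z₁)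

    ADE : ThreeElements (circle z₁)
    ADE = record { a≢b = A≢D ; a≢c = ≢-sym E≢A ; b≢c = ≢-sym E≢D ; a∈p = A∈z₁ ; b∈p = D∈z₁ ; c∈p = E∈z₁ }

    no-sixth : ∀ X → X ≢ A → X ≢ B → X ≢ C → X ≢ D → X ≢ E → ⊥
    no-sixth X X≢A X≢B X≢C X≢D X≢E
      with z₂ , A∈z₂ , D∈z₂ , X∈z₂ ← ax-i-ex A D X A≢D (≢-sym X≢A) (≢-sym X≢D)
      = [ X≢A , [ X≢D , X≢E ] ]′ (three-elements-exhaust ADE (order z₁) X∈z₁)
      where
      X∉z₀ : X ∉ circle z₀
      X∉z₀ X∈z₀ = [ X≢A , [ X≢B , X≢C ] ]′ (three-elements-exhaust (points-on z₀) (order z₀) X∈z₀)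
      ADX : ThreeElements (circle z₂)
      ADX = record { a≢b = A≢D ; a≢c = ≢-sym X≢A ; b≢c = ≢-sym X≢D ; a∈p = A∈z₂ ; b∈p = D∈z₂ ; c∈p = X∈z₂ }
      z₂≡z₁ : z₂ ≡ z₁
      z₂≡z₁ = ax-ii-uniq z₀ A D A∈z₀ D∉z₀ z₂ z₁ A∈z₂ D∈z₂ (meets-only-at ADX D∉z₀ X∉z₀) A∈z₁ D∈z₁ z₀∩z₁≡A
      X∈z₁ : X ∈ circle z₁
      X∈z₁ = subst (λ w → X ∈ circle w) z₂≡z₁ X∈z₂

    distinct : Uniqueᵥ (A ∷ B ∷ C ∷ D ∷ E ∷ [])
    distinct = (A≢B ∷ A≢C ∷ A≢D ∷ ≢-sym E≢A ∷ [])
             ∷ (B≢C ∷ ∈∧∉⇒≢ B∈z₀ D∉z₀ ∷ ∈∧∉⇒≢ B∈z₀ E∉z₀ ∷ [])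
             ∷ (∈∧∉⇒≢ C∈z₀ D∉z₀ ∷ ∈∧∉⇒≢ C∈z₀ E∉z₀ ∷ [])
             ∷ (≢-sym E≢D ∷ [])
             ∷ [] ∷ []

    covers : ∀ X → X ∈ᵥ (A ∷ B ∷ C ∷ D ∷ E ∷ [])
    covers X with X ≟ A | X ≟ B | X ≟ C | X ≟ D | X ≟ E
    ... | yes X≡A | _       | _       | _       | _       = VecAny.here X≡A
    ... | no _    | yes X≡B | _       | _       | _       = VecAny.there (VecAny.here X≡B)
    ... | no _    | no _    | yes X≡C | _       | _       = VecAny.there (VecAny.there (VecAny.here X≡C))
    ... | no _    | no _    | no _    | yes X≡D | _       =
      VecAny.there (VecAny.there (VecAny.there (VecAny.here X≡D)))
    ... | no _    | no _    | no _    | no _    | yes X≡E =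
      VecAny.there (VecAny.there (VecAny.there (VecAny.there (VecAny.here X≡E))))
    ... | no X≢A  | no X≢B  | no X≢C  | no X≢D  | no X≢E  = ⊥-elim (no-sixth X X≢A X≢B X≢C X≢D X≢E)

  points↔Fin5 : Fin n ↔ Fin 5
  points↔Fin5 = let _ , distinct , covers = five-points in enumeration⇒↔ distinct covers

  private
    σ = points↔Fin5

  point : Fin 5 → Fin n
  point = from σ

  point-injective : Injective _≡_ _≡_ point
  point-injective = Injection.injective (↔⇒↣ (↔-sym σ))

  corners : ∀ t → ThreeElements (modelCircle t)
  corners t = three-elements (modelCircle t) (≤-reflexive (sym (∣modelCircle∣≡3 t)))

  through-corners : ∀ t → let open ThreeElements (corners t) in
                    ∃[ z ] (point a ∈ circle z × point b ∈ circle z × point c ∈ circle z)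
  through-corners t = ax-i-ex (point a) (point b) (point c)
                              (a≢b ∘ point-injective) (a≢c ∘ point-injective) (b≢c ∘ point-injective)
    where open ThreeElements (corners t)

  circleOf : Fin 10 → Fin m
  circleOf t = proj₁ (through-corners t)

  ∈-circleOf : ∀ t i → i ∈ modelCircle t ⇔ point i ∈ circle (circleOf t)
  ∈-circleOf t = let _ , a∈ , b∈ , c∈ = through-corners t in
    image-of-three (corners t) point-injective (∣modelCircle∣≡3 t) (order (circleOf t)) a∈ b∈ c∈

  circleOf-injective : ∀ {t t′} → circleOf t ≡ circleOf t′ → t ≡ t′
  circleOf-injective {t} {t′} eq = modelCircle-⊆⇒≡ t t′ λ i i∈t →
    Equivalence.from (∈-circleOf t′ i) (subst (λ w → point i ∈ circle w) eq (Equivalence.to (∈-circleOf t i) i∈t))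

  circleOf-surjective : ∀ z → ∃[ t ] (circleOf t ≡ z)
  circleOf-surjective z =
    let t , a∈t , b∈t , c∈t = modelCircle-through (to σ a) (to σ b) (to σ c)
                                (a≢b ∘ to-injective) (a≢c ∘ to-injective) (b≢c ∘ to-injective)
    in t , ax-i-uniq a b c a≢b a≢c b≢c (circleOf t) z (on t a∈t) (on t b∈t) (on t c∈t) a∈p b∈p c∈p
    where
    open ThreeElements (points-on z)
    to-injective : Injective _≡_ _≡_ (to σ)
    to-injective = Injection.injective (↔⇒↣ σ)
    on : ∀ t {X} → to σ X ∈ modelCircle t → X ∈ circle (circleOf t)
    on t {X} i∈t =
      subst (λ Y → Y ∈ circle (circleOf t)) (strictlyInverseʳ σ X) (Equivalence.to (∈-circleOf t (to σ X)) i∈t)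

  -- Opaque only for type-checking speed: unfolding `to circles↔Fin10` would run the exhaustive
  -- search behind modelCircle-through during conversion checks.
  opaque
    circles↔Fin10 : Fin m ↔ Fin 10
    circles↔Fin10 = mk↔ₛ′ (proj₁ ∘ circleOf-surjective) circleOf
      (λ t → circleOf-injective (proj₂ (circleOf-surjective (circleOf t)))) (proj₂ ∘ circleOf-surjective)

    from-circles↔Fin10 : ∀ t → from circles↔Fin10 t ≡ circleOf t
    from-circles↔Fin10 t = refl

  private
    τ = circles↔Fin10

  circleOf-to : ∀ z → circleOf (to τ z) ≡ z
  circleOf-to z = trans (sym (from-circles↔Fin10 (to τ z))) (strictlyInverseʳ τ z)

  incidence-preserved : ∀ X z → X ∈ circle z ⇔ to σ X ∈ modelCircle (to τ z)
  incidence-preserved X z = subst₂ (λ Y w → Y ∈ circle w ⇔ to σ X ∈ modelCircle (to τ z))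
    (strictlyInverseʳ σ X) (circleOf-to z) (⇔.sym (∈-circleOf (to τ z) (to σ X)))

  circles-meet : ∀ z z′ → ∃[ X ] (X ∈ circle z × X ∈ circle z′)
  circles-meet z z′ = let i , i∈t , i∈t′ = modelCircles-meet (to τ z) (to τ z′) in point i , on z i∈t , on z′ i∈t′
    where
    on : ∀ z {i} → i ∈ modelCircle (to τ z) → point i ∈ circle z
    on z {i} i∈t = subst (λ w → point i ∈ circle w) (circleOf-to z) (Equivalence.to (∈-circleOf (to τ z) i) i∈t)

  vertices↔model : Vertex M ↔ ModelVertex
  vertices↔model = σ ⊎-↔ τ

  isometry : Isometry (to vertices↔model) (incidenceDistance circle) modelDistance
  isometry = incidence-preserving⇒isometry σ τ incidence-preserved

  isDist : ∀ u v → IsDist M u v (just (incidenceDistance circle u v))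
  isDist = incidenceDistance-isDist circles-meet

  basis : List (Vertex M)
  basis = map (from vertices↔model) modelBasis

  basis-unique : Unique basis
  basis-unique = Unique.map⁺ (Injection.injective (↔⇒↣ (↔-sym vertices↔model))) modelBasis-unique

  basis-resolving : Resolving M basis
  basis-resolving = resolves⇒resolving isDist (Resolves-map-from vertices↔model isometry modelBasis-resolves)

  resolving⇒4≤length : ∀ {S} → Resolving M S → 4 ≤ length S
  resolving⇒4≤length {S} res with 4 ≤? length S
  ... | yes 4≤∣S∣ = 4≤∣S∣
  ... | no 4≰∣S∣ =
    let a , b , c , S′⊆abc = length≤3⇒⊆triple (inj₁ (# 0)) (map (to vertices↔model) S)
                               (subst (_≤ 3) (sym (length-map _ S)) (≤-pred (≰⇒> 4≰∣S∣)))
    in ⊥-elim (model-no-triple-resolves a b c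
         (Resolves-⊆ S′⊆abc (Resolves-map-to vertices↔model isometry (resolving⇒resolves isDist res))))

mainTheorem10 : ∀ (M : MobiusPlane) → HasOrder M 2 → MetricDimension M 4
mainTheorem10 M order =
  (basis , basis-unique , length-map (from vertices↔model) modelBasis , basis-resolving) ,
  λ _ _ → resolving⇒4≤length
  where open OrderTwo M order
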